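{- For arbitrary quasi-partitions $(A,B,C),(D,E,F)\in W$: (1) $\mathbf v\prec_1(A,B,C)$ iff $\mathbf v\trianglelefteq(A,B,C)$ and $B\cap\mathbf v_2$ is infinite; (2) if $\mathbf v\prec_1(A,B,C)$ and $\mathbf v\prec_1(D,E,F)$, then $(A,B,C)\prec_1(D,E,F)$ iff $(A,B,C)\trianglelefteq(D,E,F)$; (3) if $(A,B,C)\trianglelefteq(D,E,F)$ and $(D,E,F)\trianglelefteq(A,B,C)$, then $(A,B,C)=(D,E,F)$.
   Context: $\mathbb N=\{1,2,3,\dots\}$. A quasi-partition is a triple $(A,B,C)$ of pairwise disjoint subsets of $\mathbb N$ with $A\cup B\cup C=\mathbb N$, $A$ and $C$ infinite, and $B$ empty or infinite; $W$ is the set of all quasi-partitions. $(A,B,C)\trianglelefteq(D,E,F)$ iff $A\subseteq D$ and $F\subseteq C$. $\mathbf v=(\mathbf v_1,\mathbf v_2,\mathbf v_3)$ with $\mathbf v_r=\{n\in\mathbb N:n\equiv r-1\pmod 3\}$ for $r=1,2,3$. The relation $\prec_1$ on $W$: $(A,B,C)\prec_1(D,E,F)$ iff $(A,B,C)\trianglelefteq(D,E,F)$ and [if $\mathbf v\trianglelefteq(A,B,C)$ and $B\cap\mathbf v_2$ is infinite, then $E\cap\mathbf v_2$ is infinite]. -}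

module Defs where

open import Level using (0ℓ)
open import Data.Nat using (ℕ; zero; suc; _≤_; _%_)
open import Data.Product using (_×_; ∃-syntax; _,_)
open import Data.Sum using (_⊎_)
open import Data.Empty using (⊥)
open import Relation.Nullary using (¬_)
open import Relation.Binary.PropositionalEquality using (_≡_)
open import Relation.Unary using (Pred; _⊆_; _∩_; _≐_)

-- Subsets of ℕ are predicates on ℕ; the paper's ℕ = {1,2,3,…}, so a
-- subset of the paper's ℕ is a predicate not containing 0.
Subset : Set₁
Subset = Pred ℕ 0ℓ

Infinite : Subset → Set
Infinite X = ∀ m → ∃[ n ] (m ≤ n × X n)

Triple : Set₁
Triple = Subset × Subset × Subset

record IsQuasiPartition (A B C : Subset) : Set where
  field
    noZeroA : ¬ A 0
    noZeroB : ¬ B 0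
    noZeroC : ¬ C 0
    disjAB  : ∀ n → A n → B n → ⊥
    disjAC  : ∀ n → A n → C n → ⊥
    disjBC  : ∀ n → B n → C n → ⊥
    cover   : ∀ n → 1 ≤ n → A n ⊎ B n ⊎ C n
    infA    : Infinite A
    infC    : Infinite C
    B-empty-or-inf : (∀ n → ¬ B n) ⊎ Infinite B

W : Triple → Set
W (A , B , C) = IsQuasiPartition A B C


_⊴_ : Triple → Triple → Set
(A , B , C) ⊴ (D , E , F) = (A ⊆ D) × (F ⊆ C)

v₁ v₂ v₃ : Subset
v₁ n = (1 ≤ n) × (n % 3 ≡ 0)
v₂ n = (1 ≤ n) × (n % 3 ≡ 1)
v₃ n = (1 ≤ n) × (n % 3 ≡ 2)

v : Triple
v = (v₁ , v₂ , v₃)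

_≺₁_ : Triple → Triple → Set
(A , B , C) ≺₁ (D , E , F) =
  ((A , B , C) ⊴ (D , E , F)) ×
  ((v ⊴ (A , B , C)) → Infinite (B ∩ v₂) → Infinite (E ∩ v₂))

_≐³_ : Triple → Triple → Set
(A , B , C) ≐³ (D , E , F) = (A ≐ D) × (B ≐ E) × (C ≐ F)

-- Part (3) is the content: a quasi-partition is determined by its outer
-- components, since its middle component is whatever they leave uncovered.
-- Parts (1) and (2) hold because the middle component of v is v₂ itself, so
-- the premise "B ∩ v₂ infinite" of ≺₁ is always met when the left side is v.
module Submission where

open import Defs
open import Data.Product using (_×_; _,_; proj₁; proj₂)
open import Data.Sum using (inj₁; inj₂)
open import Data.Empty using (⊥-elim)
open import Data.Nat using (suc; _*_; s≤s; z≤n)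
open import Data.Nat.Properties using (m≤m*n; m≤n⇒m≤1+n)
open import Data.Nat.DivMod using ([m+kn]%n≡m%n)
open import Function.Base using (id)
open import Function.Bundles using (_⇔_; mk⇔)
open import Relation.Unary using (_⊆_; _∩_)

v₂-infinite : Infinite (v₂ ∩ v₂)
v₂-infinite m = suc (m * 3) , m≤n⇒m≤1+n (m≤m*n m 3) , v₂-3m+1 , v₂-3m+1
  where
  v₂-3m+1 : v₂ (suc (m * 3))
  v₂-3m+1 = s≤s z≤n , [m+kn]%n≡m%n 1 m 3

⊴-refl : ∀ {X} → X ⊴ X
⊴-refl = id , id

v≺₁⇔v⊴×middle-infinite : ∀ {A B C} →
  (v ≺₁ (A , B , C)) ⇔ ((v ⊴ (A , B , C)) × Infinite (B ∩ v₂))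
v≺₁⇔v⊴×middle-infinite =
  mk⇔ (λ (v⊴X , keep) → v⊴X , keep (⊴-refl {v}) v₂-infinite)
      (λ (v⊴X , B∩v₂-inf) → v⊴X , λ _ _ → B∩v₂-inf)

≺₁⇔⊴-above-v : ∀ {A B C D E F} → v ≺₁ (D , E , F) →
  ((A , B , C) ≺₁ (D , E , F)) ⇔ ((A , B , C) ⊴ (D , E , F))
≺₁⇔⊴-above-v v≺₁Y =
  mk⇔ proj₁ (λ X⊴Y → X⊴Y , λ _ _ → proj₂ v≺₁Y (⊴-refl {v}) v₂-infinite)

middle-⊆ : ∀ {A B C D E F} → W (A , B , C) → W (D , E , F) →
  D ⊆ A → F ⊆ C → B ⊆ E
middle-⊆ {B = B} {E = E} wX wY D⊆A F⊆C {n} = middle-at n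
  where
  open IsQuasiPartition wX
  middle-at : ∀ m → B m → E m
  middle-at 0 b = ⊥-elim (noZeroB b)
  middle-at (suc n) b with IsQuasiPartition.cover wY (suc n) (s≤s z≤n)
  ... | inj₁ d        = ⊥-elim (disjAB _ (D⊆A d) b)
  ... | inj₂ (inj₁ e) = e
  ... | inj₂ (inj₂ f) = ⊥-elim (disjBC _ b (F⊆C f))

⊴-antisym : ∀ {A B C D E F} → W (A , B , C) → W (D , E , F) →
  (A , B , C) ⊴ (D , E , F) → (D , E , F) ⊴ (A , B , C) →
  (A , B , C) ≐³ (D , E , F)
⊴-antisym wX wY (A⊆D , F⊆C) (D⊆A , C⊆F) =
  (A⊆D , D⊆A) , (middle-⊆ wX wY D⊆A F⊆C , middle-⊆ wY wX A⊆D C⊆F) , (C⊆F , F⊆C)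

corollary2 : ∀ {A B C D E F : Subset}
    → W (A , B , C) → W (D , E , F)
    → ((v ≺₁ (A , B , C)) ⇔ ((v ⊴ (A , B , C)) × Infinite (B ∩ v₂)))
      × ((v ≺₁ (A , B , C)) → (v ≺₁ (D , E , F))
          → (((A , B , C) ≺₁ (D , E , F)) ⇔ ((A , B , C) ⊴ (D , E , F))))
      × (((A , B , C) ⊴ (D , E , F)) → ((D , E , F) ⊴ (A , B , C))
          → (A , B , C) ≐³ (D , E , F))
corollary2 wX wY =
  v≺₁⇔v⊴×middle-infinite , (λ _ → ≺₁⇔⊴-above-v) , ⊴-antisym wX wY
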